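{- Let $G$ be a connected graph with at least two vertices and maximum degree at least $3$. Then both $Y(G)$ and $\tilde Y(G)$ are connected graphs.
   Context: For each vertex $u$ of $G$ let $A(u)=\{a(u,v): uv\in E(G)\}$ and $B(u)=\{b(u,v): uv\in E(G)\}$ be sets of new pairwise distinct elements, and let $M(u)$ be the set of all subsets of $A(u)$ of even cardinality, each regarded as a new vertex. The gadget $Y(u)$ has vertex set $A(u)\cup B(u)\cup M(u)$ and, for $m\in M(u)$, the edge $\{a(u,v),m\}$ if $a(u,v)\in m$ and the edge $\{b(u,v),m\}$ if $a(u,v)\notin m$. $Y(G)$ is the disjoint union of all gadgets together with, for each edge $uv\in E(G)$, the edges $\{a(u,v),a(v,u)\}$ and $\{b(u,v),b(v,u)\}$. $\tilde Y(G)$ is obtained from $Y(G)$ by choosing one edge $u_0v_0$ of $G$ and replacing $\{a(u_0,v_0),a(v_0,u_0)\}$, $\{b(u_0,v_0),b(v_0,u_0)\}$ by $\{a(u_0,v_0),b(v_0,u_0)\}$, $\{b(u_0,v_0),a(v_0,u_0)\}$ (up to isomorphism independent of the chosen edge). -}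

module Defs where

open import Data.Nat using (ℕ; _≤_)
open import Data.Nat.Divisibility using (_∣_)
open import Data.Bool using (Bool; true; false; _∧_; _∨_)
open import Data.Fin using (Fin; _≟_)
open import Data.Fin.Subset using (Subset; _∩_; ∣_∣)
open import Data.Vec using (lookup; tabulate)
open import Data.Product using (Σ; ∃; _×_)
open import Relation.Binary.PropositionalEquality using (_≡_)
open import Relation.Binary.Construct.Closure.ReflexiveTransitive using (Star)
open import Relation.Binary.Construct.Closure.Symmetric using (SymClosure)
open import Relation.Nullary.Decidable using (⌊_⌋)

record Graph : Set where
  field
    n        : ℕ
    adj      : Fin n → Fin n → Bool
    adj-sym  : ∀ u v → adj u v ≡ adj v u
    adj-irr  : ∀ u → adj u u ≡ false

open Graph public

N : (G : Graph) → Fin (n G) → Subset (n G)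
N G u = tabulate (adj G u)

degree : (G : Graph) → Fin (n G) → ℕ
degree G u = ∣ N G u ∣

Connected : {V : Set} → (V → V → Set) → Set
Connected {V} E = ∀ (x y : V) → Star (SymClosure E) x y

Edge : (G : Graph) → Fin (n G) → Fin (n G) → Set
Edge G u v = adj G u v ≡ true

GraphConnected : Graph → Set
GraphConnected G = Connected (Edge G)

MaxDegreeAtLeast : ℕ → Graph → Set
MaxDegreeAtLeast k G = ∃ λ u → k ≤ degree G u

module Gadget (G : Graph) where
  private
    V = Fin (n G)

  -- vertices of Y(G):  a(u,v), b(u,v) for uv ∈ E(G),  and m ∈ M(u), an even
  -- subset of A(u), encoded as an even-cardinality subset S ⊆ N(u)
  -- (a(u,v) ∈ m  iff  v ∈ S).  The inclusion S ⊆ N(u) is written S ∩ N(u) ≡ S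
  -- so that its proofs are unique (no duplicate vertices in the type).
  data YVertex : Set where
    a : (u v : V) → Edge G u v → YVertex
    b : (u v : V) → Edge G u v → YVertex
    m : (u : V) (S : Subset (n G)) → S ∩ N G u ≡ S → 2 ∣ ∣ S ∣ → YVertex

  data YEdge (tw : V → V → Bool) : YVertex → YVertex → Set where
    m-a : ∀ u S (S⊆ : S ∩ N G u ≡ S) (ev : 2 ∣ ∣ S ∣) v (e : Edge G u v) → lookup S v ≡ true →
          YEdge tw (m u S S⊆ ev) (a u v e)
    m-b : ∀ u S (S⊆ : S ∩ N G u ≡ S) (ev : 2 ∣ ∣ S ∣) v (e : Edge G u v) → lookup S v ≡ false →
          YEdge tw (m u S S⊆ ev) (b u v e)
    aa  : ∀ u v (e : Edge G u v) (e' : Edge G v u) → tw u v ≡ false →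
          YEdge tw (a u v e) (a v u e')
    bb  : ∀ u v (e : Edge G u v) (e' : Edge G v u) → tw u v ≡ false →
          YEdge tw (b u v e) (b v u e')
    ab  : ∀ u v (e : Edge G u v) (e' : Edge G v u) → tw u v ≡ true →
          YEdge tw (a u v e) (b v u e')
    ba  : ∀ u v (e : Edge G u v) (e' : Edge G v u) → tw u v ≡ true →
          YEdge tw (b u v e) (a v u e')

  YEdge₀ : YVertex → YVertex → Set
  YEdge₀ = YEdge (λ _ _ → false)

  twistAt : V → V → V → V → Bool
  twistAt u₀ v₀ u v = (⌊ u ≟ u₀ ⌋ ∧ ⌊ v ≟ v₀ ⌋) ∨ (⌊ u ≟ v₀ ⌋ ∧ ⌊ v ≟ u₀ ⌋)

  YEdge~ : V → V → YVertex → YVertex → Set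
  YEdge~ u₀ v₀ = YEdge (twistAt u₀ v₀)

YConnected : Graph → Set
YConnected G = Connected (Gadget.YEdge₀ G)

YtildeConnected : (G : Graph) → (u₀ v₀ : Fin (n G)) → Edge G u₀ v₀ → Set
YtildeConnected G u₀ v₀ _ = Connected (Gadget.YEdge~ G u₀ v₀)

-- Inside a gadget Y(u) all b-ports are joined through the empty set, any two
-- a-ports a(u,v), a(u,w) through the even set {v,w}, and at a vertex of degree at least 3 the set
-- {v,w} is also adjacent to b(u,x) for a third neighbour x, joining the a-ports to the b-ports.
-- An edge uw of G joins a port of u towards w to a port of w towards u, so, G being connected,
-- every port reaches one fixed port; every vertex m ∈ M(u) is adjacent to a port of u.
module Submission where

open import Defs
open import Data.Nat using (_≤_)
open import Data.Fin using (Fin)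
open import Data.Product using (_×_)

open import Axiom.UniquenessOfIdentityProofs using (module Decidable⇒UIP)
open import Data.Bool using (Bool; true; false)
open import Data.Bool.Properties using () renaming (_≟_ to _≟ᵇ_)
open import Data.Fin using (zero; suc; _≟_)
open import Data.Fin.Subset using (Subset; _∈_; _∉_; _⊆_; _∩_; _∪_; ∁; ⁅_⁆; ⊥; ∣_∣; inside; outside)
open import Data.Fin.Subset.Properties
  using (_∈?_; nonempty?; ⊥⊆; ∉⊥; ⊆-antisym; p∩q⊆p; x∈p∩q⁺; x∈p∩q⁻; x∈p∪q⁺; x∈p∪q⁻;
         x∈∁p⇒x∉p; x∉p⇒x∈∁p; p⊆q⇒∣p∣≤∣q∣; x∈⁅x⁆; x∈⁅y⁆⇒x≡y; x∉⁅y⁆⇒x≢y;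
         ∣⊥∣≡0; ∣⁅x⁆∣≡1; ∪-identityˡ; ∪-identityʳ)
open import Data.Nat as ℕ using (ℕ; _<_; s≤s; z≤n)
open import Data.Nat.Divisibility using (_∣_; divides)
open import Data.Nat.Properties using (≤-trans; <⇒≱)
open import Data.Product using (∃; ∃₂; _,_; proj₁; proj₂)
open import Data.Sum as Sum using (_⊎_; inj₁; inj₂)
open import Data.Vec using (lookup)
open import Data.Vec.Properties using (lookup∘tabulate; []=⇒lookup; lookup⇒[]=)
open import Function using (_∘_)
open import Relation.Binary.Construct.Closure.ReflexiveTransitive using (Star; ε; _◅_; _◅◅_; reverse)
open import Relation.Binary.Construct.Closure.Symmetric using (SymClosure; fwd; bwd; symmetric)
open import Relation.Binary.PropositionalEquality using (_≡_; _≢_; refl; sym; trans; cong; subst; ≢-sym)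
open import Relation.Nullary using (yes; no; contradiction)
open import Relation.Nullary.Decidable using (decidable-stable)

≡ᵇ-irrelevant : {x y : Bool} (p q : x ≡ y) → p ≡ q
≡ᵇ-irrelevant = Decidable⇒UIP.≡-irrelevant _≟ᵇ_

Star-root⇒Connected : {V : Set} {E : V → V → Set} (r : V) →
                      (∀ x → Star (SymClosure E) x r) → Connected E
Star-root⇒Connected r reach x y = reach x ◅◅ reverse (symmetric _) (reach y)

module _ {k : ℕ} where

  ∉⇒lookup≡outside : {x : Fin k} {p : Subset k} → x ∉ p → lookup p x ≡ outside
  ∉⇒lookup≡outside {x} {p} x∉p with lookup p x in eq
  ... | outside = refl
  ... | inside  = contradiction (lookup⇒[]= x p eq) x∉p

  p⊆q⇒p∩q≡p : {p q : Subset k} → p ⊆ q → p ∩ q ≡ p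
  p⊆q⇒p∩q≡p {p} {q} p⊆q = ⊆-antisym (p∩q⊆p p q) (λ x∈p → x∈p∩q⁺ (x∈p , p⊆q x∈p))

  ∣p∣<∣q∣⇒∃∈q∉p : (p q : Subset k) → ∣ p ∣ < ∣ q ∣ → ∃ λ x → x ∈ q × x ∉ p
  ∣p∣<∣q∣⇒∃∈q∉p p q ∣p∣<∣q∣ with nonempty? (q ∩ ∁ p)
  ... | yes (x , x∈q∩∁p) = x , proj₁ x∈q×x∈∁p , x∈∁p⇒x∉p (proj₂ x∈q×x∈∁p)
    where x∈q×x∈∁p = x∈p∩q⁻ q (∁ p) x∈q∩∁p
  ... | no q∩∁p-empty = contradiction (p⊆q⇒∣p∣≤∣q∣ q⊆p) (<⇒≱ ∣p∣<∣q∣)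
    where
    q⊆p : q ⊆ p
    q⊆p {x} x∈q = decidable-stable (x ∈? p) (λ x∉p → q∩∁p-empty (x , x∈p∩q⁺ (x∈q , x∉p⇒x∈∁p x∉p)))

  x∈⁅x⁆∪⁅y⁆ : (x y : Fin k) → x ∈ ⁅ x ⁆ ∪ ⁅ y ⁆
  x∈⁅x⁆∪⁅y⁆ x y = x∈p∪q⁺ (inj₁ (x∈⁅x⁆ x))

  y∈⁅x⁆∪⁅y⁆ : (x y : Fin k) → y ∈ ⁅ x ⁆ ∪ ⁅ y ⁆
  y∈⁅x⁆∪⁅y⁆ x y = x∈p∪q⁺ (inj₂ (x∈⁅x⁆ y))

  z∈⁅x⁆∪⁅y⁆⇒z≡x⊎z≡y : {x y z : Fin k} → z ∈ ⁅ x ⁆ ∪ ⁅ y ⁆ → z ≡ x ⊎ z ≡ y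
  z∈⁅x⁆∪⁅y⁆⇒z≡x⊎z≡y {x} {y} = Sum.map (x∈⁅y⁆⇒x≡y x) (x∈⁅y⁆⇒x≡y y) ∘ x∈p∪q⁻ ⁅ x ⁆ ⁅ y ⁆

∣⁅x⁆∪⁅y⁆∣≡2 : {k : ℕ} {x y : Fin k} → x ≢ y → ∣ ⁅ x ⁆ ∪ ⁅ y ⁆ ∣ ≡ 2
∣⁅x⁆∪⁅y⁆∣≡2 {x = zero}  {zero}  x≢y = contradiction refl x≢y
∣⁅x⁆∪⁅y⁆∣≡2 {x = zero}  {suc y} _   = cong ℕ.suc (trans (cong ∣_∣ (∪-identityˡ ⁅ y ⁆)) (∣⁅x⁆∣≡1 y))
∣⁅x⁆∪⁅y⁆∣≡2 {x = suc x} {zero}  _   = cong ℕ.suc (trans (cong ∣_∣ (∪-identityʳ ⁅ x ⁆)) (∣⁅x⁆∣≡1 x))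
∣⁅x⁆∪⁅y⁆∣≡2 {x = suc x} {suc y} x≢y = ∣⁅x⁆∪⁅y⁆∣≡2 (x≢y ∘ cong suc)

3≤∣p∣⇒three-elements : {k : ℕ} (p : Subset k) → 3 ≤ ∣ p ∣ →
  ∃₂ λ x y → ∃ λ z → x ∈ p × y ∈ p × z ∈ p × x ≢ y × z ∉ ⁅ x ⁆ ∪ ⁅ y ⁆
3≤∣p∣⇒three-elements {k} p 3≤∣p∣
  with ∣p∣<∣q∣⇒∃∈q∉p ⊥ p (subst (_< ∣ p ∣) (sym (∣⊥∣≡0 k)) (≤-trans (s≤s z≤n) 3≤∣p∣))
... | x , x∈p , _
  with ∣p∣<∣q∣⇒∃∈q∉p ⁅ x ⁆ p (subst (_< ∣ p ∣) (sym (∣⁅x⁆∣≡1 x)) (≤-trans (s≤s (s≤s z≤n)) 3≤∣p∣))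
... | y , y∈p , y∉⁅x⁆
  with x≢y ← ≢-sym (x∉⁅y⁆⇒x≢y y∉⁅x⁆)
  with ∣p∣<∣q∣⇒∃∈q∉p (⁅ x ⁆ ∪ ⁅ y ⁆) p (subst (_< ∣ p ∣) (sym (∣⁅x⁆∪⁅y⁆∣≡2 x≢y)) 3≤∣p∣)
... | z , z∈p , z∉⁅x⁆∪⁅y⁆ = x , y , z , x∈p , y∈p , z∈p , x≢y , z∉⁅x⁆∪⁅y⁆

module _ (G : Graph) {u v : Fin (n G)} where

  Edge-sym : Edge G u v → Edge G v u
  Edge-sym e = trans (adj-sym G v u) e

  Edge⇒∈N : Edge G u v → v ∈ N G u
  Edge⇒∈N e = lookup⇒[]= v (N G u) (trans (lookup∘tabulate (adj G u) v) e)

  ∈N⇒Edge : v ∈ N G u → Edge G u v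
  ∈N⇒Edge v∈N = trans (sym (lookup∘tabulate (adj G u) v)) ([]=⇒lookup v∈N)

Connected⇒∃-neighbour : (G : Graph) → GraphConnected G → {u₁ v₁ : Fin (n G)} → Edge G u₁ v₁ →
                        (u : Fin (n G)) → ∃ (Edge G u)
Connected⇒∃-neighbour G conn {u₁} {v₁} e₁ u with conn u u₁
... | ε           = v₁ , e₁
... | fwd e ◅ _   = _ , e
... | bwd e ◅ _   = _ , Edge-sym G e

module Ports (G : Graph) (tw : Fin (n G) → Fin (n G) → Bool) where
  open Gadget G

  private
    V = Fin (n G)
    variable
      u v w x : V

  infix 4 _⇝_
  _⇝_ : YVertex → YVertex → Set
  _⇝_ = Star (SymClosure (YEdge tw))

  forth : ∀ {y z} → YEdge tw y z → y ⇝ z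
  forth e = fwd e ◅ ε

  back : ∀ {y z} → YEdge tw z y → y ⇝ z
  back e = bwd e ◅ ε

  mVertex : (u : V) (S : Subset (n G)) → S ⊆ N G u → 2 ∣ ∣ S ∣ → YVertex
  mVertex u S S⊆N 2∣∣S∣ = m u S (p⊆q⇒p∩q≡p S⊆N) 2∣∣S∣

  module _ {S : Subset (n G)} (S⊆N : S ⊆ N G u) (2∣∣S∣ : 2 ∣ ∣ S ∣) (e : Edge G u v) where

    mVertex—a : v ∈ S → YEdge tw (mVertex u S S⊆N 2∣∣S∣) (a u v e)
    mVertex—a v∈S = m-a u S _ 2∣∣S∣ v e ([]=⇒lookup v∈S)

    mVertex—b : v ∉ S → YEdge tw (mVertex u S S⊆N 2∣∣S∣) (b u v e)
    mVertex—b v∉S = m-b u S _ 2∣∣S∣ v e (∉⇒lookup≡outside v∉S)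

  b-ports-joined : (e : Edge G u v) (e' : Edge G u w) → b u v e ⇝ b u w e'
  b-ports-joined e e' = back (mVertex—b ⊥⊆ 2∣∣⊥∣ e ∉⊥) ◅◅ forth (mVertex—b ⊥⊆ 2∣∣⊥∣ e' ∉⊥)
    where 2∣∣⊥∣ = divides 0 (∣⊥∣≡0 (n G))

  module _ (e : Edge G u v) (e' : Edge G u w) (v≢w : v ≢ w) where

    pair⊆N : ⁅ v ⁆ ∪ ⁅ w ⁆ ⊆ N G u
    pair⊆N x∈pair with z∈⁅x⁆∪⁅y⁆⇒z≡x⊎z≡y x∈pair
    ... | inj₁ refl = Edge⇒∈N G e
    ... | inj₂ refl = Edge⇒∈N G e'

    2∣∣pair∣ : 2 ∣ ∣ ⁅ v ⁆ ∪ ⁅ w ⁆ ∣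
    2∣∣pair∣ = divides 1 (∣⁅x⁆∪⁅y⁆∣≡2 v≢w)

    mPair : YVertex
    mPair = mVertex u (⁅ v ⁆ ∪ ⁅ w ⁆) pair⊆N 2∣∣pair∣

    mPair—a₁ : YEdge tw mPair (a u v e)
    mPair—a₁ = mVertex—a pair⊆N 2∣∣pair∣ e (x∈⁅x⁆∪⁅y⁆ v w)

    mPair—a₂ : YEdge tw mPair (a u w e')
    mPair—a₂ = mVertex—a pair⊆N 2∣∣pair∣ e' (y∈⁅x⁆∪⁅y⁆ v w)

  a-ports-joined : (e : Edge G u v) (e' : Edge G u w) → a u v e ⇝ a u w e'
  a-ports-joined {v = v} {w = w} e e' with v ≟ w
  ... | yes refl rewrite ≡ᵇ-irrelevant e e' = ε
  ... | no v≢w = back (mPair—a₁ e e' v≢w) ◅◅ forth (mPair—a₂ e e' v≢w)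

  module Rooted (r : YVertex) where

    Reaches : V → Set
    Reaches u = (∀ {v} (e : Edge G u v) → a u v e ⇝ r) × (∀ {v} (e : Edge G u v) → b u v e ⇝ r)

    crossing : (e : Edge G u w) → Reaches w → a u w e ⇝ r × b u w e ⇝ r
    crossing {u} {w} e (a⇝r , b⇝r) with e' ← Edge-sym G e | tw u w in twisted
    ... | false = forth (aa u w e e' twisted) ◅◅ a⇝r e' , forth (bb u w e e' twisted) ◅◅ b⇝r e'
    ... | true  = forth (ab u w e e' twisted) ◅◅ b⇝r e' , forth (ba u w e e' twisted) ◅◅ a⇝r e'

    Reaches-adjacent : Edge G u w → Reaches w → Reaches u
    Reaches-adjacent e R =
      (λ e₁ → a-ports-joined e₁ e ◅◅ proj₁ (crossing e R)) ,
      (λ e₁ → b-ports-joined e₁ e ◅◅ proj₂ (crossing e R))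

    Reaches-walk : Star (SymClosure (Edge G)) u w → Reaches w → Reaches u
    Reaches-walk ε           R = R
    Reaches-walk (fwd e ◅ p) R = Reaches-adjacent e (Reaches-walk p R)
    Reaches-walk (bwd e ◅ p) R = Reaches-adjacent (Edge-sym G e) (Reaches-walk p R)

    all-reach : GraphConnected G → Edge G u v → Reaches u → ∀ y → y ⇝ r
    all-reach conn e₁ R (a u _ e) = proj₁ (Reaches-walk (conn u _) R) e
    all-reach conn e₁ R (b u _ e) = proj₂ (Reaches-walk (conn u _) R) e
    all-reach conn e₁ R (m u S S∩N≡S 2∣∣S∣) with Connected⇒∃-neighbour G conn e₁ u
    ... | v , e with lookup S v in v∈?S
    ... | true  = forth (m-a u S S∩N≡S 2∣∣S∣ v e v∈?S) ◅◅ proj₁ (Reaches-walk (conn u _) R) e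
    ... | false = forth (m-b u S S∩N≡S 2∣∣S∣ v e v∈?S) ◅◅ proj₂ (Reaches-walk (conn u _) R) e

  hub-reaches : (e : Edge G u v) (e' : Edge G u w) (e'' : Edge G u x) (v≢w : v ≢ w) →
                x ∉ ⁅ v ⁆ ∪ ⁅ w ⁆ → Rooted.Reaches (b u v e) u
  hub-reaches e e' e'' v≢w x∉pair =
    (λ e₁ → a-ports-joined e₁ e ◅◅ back (mPair—a₁ e e' v≢w) ◅◅
            forth (mVertex—b (pair⊆N e e' v≢w) (2∣∣pair∣ e e' v≢w) e'' x∉pair) ◅◅ b-ports-joined e'' e) ,
    (λ e₁ → b-ports-joined e₁ e)

  Y-connected : GraphConnected G → MaxDegreeAtLeast 3 G → Connected (YEdge tw)
  Y-connected conn (u , 3≤deg) with 3≤∣p∣⇒three-elements (N G u) 3≤deg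
  ... | v , w , x , v∈N , w∈N , x∈N , v≢w , x∉pair =
    Star-root⇒Connected (b u v e) (Rooted.all-reach (b u v e) conn e
      (hub-reaches e (∈N⇒Edge G w∈N) (∈N⇒Edge G x∈N) v≢w x∉pair))
    where e = ∈N⇒Edge G v∈N

proposition6p9 : (G : Graph) → GraphConnected G → 2 ≤ n G → MaxDegreeAtLeast 3 G →
    YConnected G × ((u₀ v₀ : Fin (n G)) → (e : Edge G u₀ v₀) → YtildeConnected G u₀ v₀ e)
proposition6p9 G conn _ Δ≥3 =
  Ports.Y-connected G (λ _ _ → false) conn Δ≥3 ,
  λ u₀ v₀ _ → Ports.Y-connected G (Gadget.twistAt G u₀ v₀) conn Δ≥3
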